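{- Let $\mathcal L$ be a cartesian symmetric monoidal category in which $I=1\& 1$ is exponentiable, with $S=I\multimap-$, $\pi_i=\bar w_i$ and $\sigma=\bar\Delta$. The following are equivalent: (1) for every object $X$ the morphisms $X\otimes w_0,X\otimes w_1$ are jointly epic, and $(S,\pi_0,\pi_1,\sigma)$ satisfies (S-witness); (2) $(S,\pi_0,\pi_1,\sigma)$ is a summability structure, that is, $\mathcal L$ is canonically summable.
   Context: $\mathcal L$ is a symmetric monoidal category $(\otimes,1,\rho,\lambda,\dots)$ enriched over pointed sets (each hom-set has a zero $0$, absorbing for composition, and $f\otimes0=0\otimes f=0$), with finite cartesian products $\&$. $I=1\& 1$ exponentiable means $-\otimes I$ has a right adjoint $S=I\multimap-$, with evaluation $\mathrm{ev}$. Let $w_0=\langle\mathrm{id}_1,0\rangle$, $w_1=\langle0,\mathrm{id}_1\rangle$, $\Delta=\langle\mathrm{id}_1,\mathrm{id}_1\rangle\in\mathcal L(1,I)$; for $\phi\in\mathcal L(1,I)$, $\bar\phi_X=\mathrm{ev}\circ((I\multimap X)\otimes\phi)\circ\rho^{ -1}\in\mathcal L(I\multimap X,X)$. Given endofunctor $S$ with $S0=0$ and natural $\pi_0,\pi_1,\sigma:S\Rightarrow\mathrm{Id}$ with $\pi_0,\pi_1$ jointly monic: $f_0,f_1\in\mathcal L(X,Y)$ are summable if there is (unique) $\langle f_0,f_1\rangle_S\in\mathcal L(X,SY)$ with $\pi_i\langle f_0,f_1\rangle_S=f_i$, and then $f_0+f_1=\sigma\langle f_0,f_1\rangle_S$.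 (S-witness): if $(f_{00},f_{01})$, $(f_{10},f_{11})$ are summable and $(f_{00}+f_{01},f_{10}+f_{11})$ is summable, then $\langle f_{00},f_{01}\rangle_S,\langle f_{10},f_{11}\rangle_S$ are summable. A summability structure is such a tuple satisfying (S-com) $\pi_1,\pi_0$ summable and $\sigma\langle\pi_1,\pi_0\rangle_S=\sigma$; (S-zero) $f,0$ summable with $f+0=f$ for all $f$; (S-witness); and (S-assoc) $S\sigma_X\circ c_X=\sigma_{SX}$ where $c_X$ is the unique endomorphism of $S^2X$ with $\pi_{i,X}\pi_{j,SX}c_X=\pi_{j,X}\pi_{i,SX}$ for all $i,j$. $\mathcal L$ is called canonically summable if $(I\multimap-,\bar w_0,\bar w_1,\bar\Delta)$ is a summability structure. -}

module Defs where

open import Level using (Level; _⊔_) renaming (suc to lsuc)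
open import Relation.Binary.PropositionalEquality using (_≡_)
open import Data.Product using (Σ; Σ-syntax; _×_; _,_; proj₁)
open import Data.Bool using (Bool; false; true)
open import Function.Bundles using (_⇔_)

record PointedCategory (o ℓ : Level) : Set (lsuc (o ⊔ ℓ)) where
  infixr 9 _∘_
  infix  4 _⇒_
  field
    Obj  : Set o
    _⇒_  : Obj → Obj → Set ℓ
    id   : ∀ {A} → A ⇒ A
    _∘_  : ∀ {A B C} → B ⇒ C → A ⇒ B → A ⇒ C
    assoc     : ∀ {A B C D} {f : A ⇒ B} {g : B ⇒ C} {h : C ⇒ D} →
                (h ∘ g) ∘ f ≡ h ∘ (g ∘ f)
    identityˡ : ∀ {A B} {f : A ⇒ B} → id ∘ f ≡ f
    identityʳ : ∀ {A B} {f : A ⇒ B} → f ∘ id ≡ f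
    0m     : ∀ {A B} → A ⇒ B
    zeroˡ  : ∀ {A B C} {f : A ⇒ B} → 0m {B} {C} ∘ f ≡ 0m
    zeroʳ  : ∀ {A B C} {g : B ⇒ C} → g ∘ 0m {A} {B} ≡ 0m

record CartesianSMC (o ℓ : Level) : Set (lsuc (o ⊔ ℓ)) where
  infixr 10 _⊗₀_ _⊗₁_
  field
    cat : PointedCategory o ℓ
  open PointedCategory cat public
  field
    _⊗₀_ : Obj → Obj → Obj
    _⊗₁_ : ∀ {A B C D} → A ⇒ B → C ⇒ D → (A ⊗₀ C) ⇒ (B ⊗₀ D)
    ⊗-id : ∀ {A B} → id {A} ⊗₁ id {B} ≡ id
    ⊗-∘  : ∀ {A B C D E F} {f : A ⇒ B} {g : B ⇒ C} {h : D ⇒ E} {k : E ⇒ F} →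
           (g ∘ f) ⊗₁ (k ∘ h) ≡ (g ⊗₁ k) ∘ (f ⊗₁ h)
    ⊗-zeroˡ : ∀ {A B C D} {f : C ⇒ D} → 0m {A} {B} ⊗₁ f ≡ 0m
    ⊗-zeroʳ : ∀ {A B C D} {f : A ⇒ B} → f ⊗₁ 0m {C} {D} ≡ 0m
    𝟙 : Obj
    α⇒ : ∀ {A B C} → (A ⊗₀ B) ⊗₀ C ⇒ A ⊗₀ (B ⊗₀ C)
    α⇐ : ∀ {A B C} → A ⊗₀ (B ⊗₀ C) ⇒ (A ⊗₀ B) ⊗₀ C
    α-isoˡ : ∀ {A B C} → α⇐ ∘ α⇒ {A} {B} {C} ≡ id
    α-isoʳ : ∀ {A B C} → α⇒ ∘ α⇐ {A} {B} {C} ≡ id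
    α-nat  : ∀ {A B C D E F} {f : A ⇒ D} {g : B ⇒ E} {h : C ⇒ F} →
             α⇒ ∘ ((f ⊗₁ g) ⊗₁ h) ≡ (f ⊗₁ (g ⊗₁ h)) ∘ α⇒
    λ⇒ : ∀ {A} → 𝟙 ⊗₀ A ⇒ A
    λ⇐ : ∀ {A} → A ⇒ 𝟙 ⊗₀ A
    λ-isoˡ : ∀ {A} → λ⇐ ∘ λ⇒ {A} ≡ id
    λ-isoʳ : ∀ {A} → λ⇒ ∘ λ⇐ {A} ≡ id
    λ-nat  : ∀ {A B} {f : A ⇒ B} → λ⇒ ∘ (id ⊗₁ f) ≡ f ∘ λ⇒
    ρ⇒ : ∀ {A} → A ⊗₀ 𝟙 ⇒ A
    ρ⇐ : ∀ {A} → A ⇒ A ⊗₀ 𝟙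
    ρ-isoˡ : ∀ {A} → ρ⇐ ∘ ρ⇒ {A} ≡ id
    ρ-isoʳ : ∀ {A} → ρ⇒ ∘ ρ⇐ {A} ≡ id
    ρ-nat  : ∀ {A B} {f : A ⇒ B} → ρ⇒ ∘ (f ⊗₁ id) ≡ f ∘ ρ⇒
    γ : ∀ {A B} → A ⊗₀ B ⇒ B ⊗₀ A
    γ-nat : ∀ {A B C D} {f : A ⇒ B} {g : C ⇒ D} →
            γ ∘ (f ⊗₁ g) ≡ (g ⊗₁ f) ∘ γ
    γ-invol : ∀ {A B} → γ {B} {A} ∘ γ {A} {B} ≡ id
    pentagon : ∀ {A B C D} →
      α⇒ {A} {B} {C ⊗₀ D} ∘ α⇒ {A ⊗₀ B} {C} {D}
        ≡ (id ⊗₁ α⇒) ∘ (α⇒ ∘ (α⇒ ⊗₁ id))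
    triangle : ∀ {A B} → (id {A} ⊗₁ λ⇒ {B}) ∘ α⇒ ≡ ρ⇒ ⊗₁ id
    hexagon : ∀ {A B C} →
      (id {B} ⊗₁ γ {A} {C}) ∘ (α⇒ ∘ (γ ⊗₁ id))
        ≡ α⇒ ∘ (γ {A} {B ⊗₀ C} ∘ α⇒)
    ⊤  : Obj
    !  : ∀ {A} → A ⇒ ⊤
    !-unique : ∀ {A} (f : A ⇒ ⊤) → f ≡ !
    _&_   : Obj → Obj → Obj
    p₁    : ∀ {A B} → A & B ⇒ A
    p₂    : ∀ {A B} → A & B ⇒ B
    ⟨_,_⟩ : ∀ {A B C} → C ⇒ A → C ⇒ B → C ⇒ A & B
    p₁-β  : ∀ {A B C} {f : C ⇒ A} {g : C ⇒ B} → p₁ ∘ ⟨ f , g ⟩ ≡ f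
    p₂-β  : ∀ {A B C} {f : C ⇒ A} {g : C ⇒ B} → p₂ ∘ ⟨ f , g ⟩ ≡ g
    ⟨⟩-unique : ∀ {A B C} {f : C ⇒ A} {g : C ⇒ B} (h : C ⇒ A & B) →
                p₁ ∘ h ≡ f → p₂ ∘ h ≡ g → h ≡ ⟨ f , g ⟩

-- I = 1 & 1 and its exponentiability: - ⊗ I has a right adjoint I ⊸ -,
-- presented by the universal property of the evaluation.

module _ {o ℓ} (C : CartesianSMC o ℓ) where
  open CartesianSMC C

  I : Obj
  I = 𝟙 & 𝟙

  record ExponentiableI : Set (o ⊔ ℓ) where
    field
      _⊸I : Obj → Obj
      ev  : ∀ {X} → (X ⊸I) ⊗₀ I ⇒ X
      cur : ∀ {Z X} → Z ⊗₀ I ⇒ X → Z ⇒ X ⊸I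
      ev-cur : ∀ {Z X} {f : Z ⊗₀ I ⇒ X} → ev ∘ (cur f ⊗₁ id) ≡ f
      cur-unique : ∀ {Z X} {f : Z ⊗₀ I ⇒ X} (g : Z ⇒ X ⊸I) →
                   ev ∘ (g ⊗₁ id) ≡ f → g ≡ cur f

module Summability {o ℓ} (𝒞 : PointedCategory o ℓ)
  (S₀ : PointedCategory.Obj 𝒞 → PointedCategory.Obj 𝒞)
  (S₁ : ∀ {X Y} → PointedCategory._⇒_ 𝒞 X Y → PointedCategory._⇒_ 𝒞 (S₀ X) (S₀ Y))
  (π₀ π₁ σ : ∀ {X} → PointedCategory._⇒_ 𝒞 (S₀ X) X) where
  open PointedCategory 𝒞

  Witness : ∀ {X Y} → X ⇒ Y → X ⇒ Y → Set ℓ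
  Witness {X} {Y} f₀ f₁ = Σ[ h ∈ X ⇒ S₀ Y ] (π₀ ∘ h ≡ f₀ × π₁ ∘ h ≡ f₁)

  Summable : ∀ {X Y} → X ⇒ Y → X ⇒ Y → Set ℓ
  Summable = Witness

  IsFunctor : Set (o ⊔ ℓ)
  IsFunctor = (∀ {X} → S₁ (id {X}) ≡ id)
            × (∀ {X Y Z} {f : X ⇒ Y} {g : Y ⇒ Z} → S₁ (g ∘ f) ≡ S₁ g ∘ S₁ f)

  PreservesZero : Set (o ⊔ ℓ)
  PreservesZero = ∀ {X Y} → S₁ (0m {X} {Y}) ≡ 0m

  IsNatural : (∀ {X} → S₀ X ⇒ X) → Set (o ⊔ ℓ)
  IsNatural τ = ∀ {X Y} {f : X ⇒ Y} → τ ∘ S₁ f ≡ f ∘ τ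

  JointlyMonic : Set (o ⊔ ℓ)
  JointlyMonic = ∀ {Z X} (f g : Z ⇒ S₀ X) →
                 π₀ ∘ f ≡ π₀ ∘ g → π₁ ∘ f ≡ π₁ ∘ g → f ≡ g

  S-com : Set (o ⊔ ℓ)
  S-com = ∀ {X} → Σ[ w ∈ Witness (π₁ {X}) (π₀ {X}) ] (σ ∘ proj₁ w ≡ σ)

  S-zero : Set (o ⊔ ℓ)
  S-zero = ∀ {X Y} (f : X ⇒ Y) →
           Σ[ w ∈ Witness f (0m {X} {Y}) ] (σ ∘ proj₁ w ≡ f)

  S-witness : Set (o ⊔ ℓ)
  S-witness = ∀ {X Y} {f₀₀ f₀₁ f₁₀ f₁₁ : X ⇒ Y}
    (w₀ : Witness f₀₀ f₀₁) (w₁ : Witness f₁₀ f₁₁) →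
    Summable (σ ∘ proj₁ w₀) (σ ∘ proj₁ w₁) →
    Summable (proj₁ w₀) (proj₁ w₁)

  π : Bool → ∀ {X} → S₀ X ⇒ X
  π false = π₀
  π true  = π₁

  IsFlip : ∀ {X} → S₀ (S₀ X) ⇒ S₀ (S₀ X) → Set ℓ
  IsFlip {X} c = ∀ (i j : Bool) →
    π i {X} ∘ (π j {S₀ X} ∘ c) ≡ π j {X} ∘ π i {S₀ X}

  S-assoc : Set (o ⊔ ℓ)
  S-assoc = ∀ {X} → Σ[ c ∈ S₀ (S₀ X) ⇒ S₀ (S₀ X) ]
              (IsFlip c × S₁ (σ {X}) ∘ c ≡ σ {S₀ X})

  record IsSummabilityStructure : Set (o ⊔ ℓ) where
    field
      functor      : IsFunctor
      S0≡0         : PreservesZero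
      π₀-natural   : IsNatural π₀
      π₁-natural   : IsNatural π₁
      σ-natural    : IsNatural σ
      jointlyMonic : JointlyMonic
      s-com        : S-com
      s-zero       : S-zero
      s-witness    : S-witness
      s-assoc      : S-assoc

module Canonical {o ℓ} (C : CartesianSMC o ℓ) (E : ExponentiableI C) where
  open CartesianSMC C
  open ExponentiableI E

  w₀ w₁ Δ : 𝟙 ⇒ I C
  w₀ = ⟨ id , 0m ⟩
  w₁ = ⟨ 0m , id ⟩
  Δ  = ⟨ id , id ⟩

  S₀ : Obj → Obj
  S₀ X = X ⊸I

  S₁ : ∀ {X Y} → X ⇒ Y → S₀ X ⇒ S₀ Y
  S₁ f = cur (f ∘ ev)

  bar : 𝟙 ⇒ I C → ∀ {X} → S₀ X ⇒ X
  bar φ = ev ∘ ((id ⊗₁ φ) ∘ ρ⇐)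

  open Summability cat S₀ S₁ (bar w₀) (bar w₁) (bar Δ) public

  JointlyEpicW : Set (o ⊔ ℓ)
  JointlyEpicW = ∀ {X Z} (f g : X ⊗₀ I C ⇒ Z) →
    f ∘ (id ⊗₁ w₀) ≡ g ∘ (id ⊗₁ w₀) →
    f ∘ (id ⊗₁ w₁) ≡ g ∘ (id ⊗₁ w₁) → f ≡ g

  Condition1 : Set (o ⊔ ℓ)
  Condition1 = JointlyEpicW × S-witness

  CanonicallySummable : Set (o ⊔ ℓ)
  CanonicallySummable = IsSummabilityStructure

{-# OPTIONS --safe #-}
module Submission where

-- Everything is transported along the currying bijection
-- h ↦ ev ∘ (h ⊗ I) between maps Z ⇒ I ⊸ X and maps Z ⊗ I ⇒ X: under it,
-- post-composing with φ̄ becomes pre-composing with Z ⊗ φ (up to the unitor).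
-- Hence π̄₀, π̄₁ are jointly monic exactly when the Z ⊗ wᵢ are jointly epic,
-- (S-com) and (S-zero) are witnessed by currying the swap I ⇒ I and the
-- projection p₁ : I ⇒ 1, and (S-witness) applied to the witnesses S π̄₀, S π̄₁
-- of the sums π̄ᵢπ̄ⱼ produces the flip c of (S-assoc).

open import Defs
open import Function.Bundles using (_⇔_; mk⇔)
open import Relation.Binary.PropositionalEquality
open import Data.Product using (_,_; proj₁; proj₂)
open import Data.Bool using (false; true)

module SymmetricMonoidalProperties {o ℓ} (C : CartesianSMC o ℓ) where
  open CartesianSMC C
  open ≡-Reasoning

  ⊗id-∘ : ∀ {A B D E} {f : A ⇒ B} {g : B ⇒ D} →
          (g ∘ f) ⊗₁ id {E} ≡ (g ⊗₁ id) ∘ (f ⊗₁ id)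
  ⊗id-∘ {f = f} {g} = trans (cong ((g ∘ f) ⊗₁_) (sym identityˡ)) ⊗-∘

  id⊗-∘ : ∀ {A B D E} {f : A ⇒ B} {g : B ⇒ D} →
          id {E} ⊗₁ (g ∘ f) ≡ (id ⊗₁ g) ∘ (id ⊗₁ f)
  id⊗-∘ {f = f} {g} = trans (cong (_⊗₁ (g ∘ f)) (sym identityˡ)) ⊗-∘

  ⊗-interchange : ∀ {A B D E} {f : A ⇒ B} {g : D ⇒ E} →
                  (id ⊗₁ g) ∘ (f ⊗₁ id) ≡ (f ⊗₁ id) ∘ (id ⊗₁ g)
  ⊗-interchange {f = f} {g} = begin
    (id ⊗₁ g) ∘ (f ⊗₁ id) ≡⟨ sym ⊗-∘ ⟩
    (id ∘ f) ⊗₁ (g ∘ id)  ≡⟨ cong₂ _⊗₁_ (trans identityˡ (sym identityʳ))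
                                        (trans identityʳ (sym identityˡ)) ⟩
    (f ∘ id) ⊗₁ (id ∘ g)  ≡⟨ ⊗-∘ ⟩
    (f ⊗₁ id) ∘ (id ⊗₁ g) ∎

  ρ⇐-natural : ∀ {A B} {f : A ⇒ B} → ρ⇐ ∘ f ≡ (f ⊗₁ id) ∘ ρ⇐
  ρ⇐-natural {f = f} = begin
    ρ⇐ ∘ f                      ≡⟨ cong (ρ⇐ ∘_) (sym (trans (cong (f ∘_) ρ-isoʳ) identityʳ)) ⟩
    ρ⇐ ∘ (f ∘ (ρ⇒ ∘ ρ⇐))        ≡⟨ cong (ρ⇐ ∘_) (sym assoc) ⟩
    ρ⇐ ∘ ((f ∘ ρ⇒) ∘ ρ⇐)        ≡⟨ cong (λ k → ρ⇐ ∘ (k ∘ ρ⇐)) (sym ρ-nat) ⟩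
    ρ⇐ ∘ ((ρ⇒ ∘ (f ⊗₁ id)) ∘ ρ⇐) ≡⟨ cong (ρ⇐ ∘_) assoc ⟩
    ρ⇐ ∘ (ρ⇒ ∘ ((f ⊗₁ id) ∘ ρ⇐)) ≡⟨ sym assoc ⟩
    (ρ⇐ ∘ ρ⇒) ∘ ((f ⊗₁ id) ∘ ρ⇐) ≡⟨ cong (_∘ ((f ⊗₁ id) ∘ ρ⇐)) ρ-isoˡ ⟩
    id ∘ ((f ⊗₁ id) ∘ ρ⇐)        ≡⟨ identityˡ ⟩
    (f ⊗₁ id) ∘ ρ⇐               ∎

  ρ⇐-cancelʳ : ∀ {A B} {f g : A ⊗₀ 𝟙 ⇒ B} → f ∘ ρ⇐ ≡ g ∘ ρ⇐ → f ≡ g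
  ρ⇐-cancelʳ {f = f} {g} e = begin
    f                 ≡⟨ sym (trans (cong (f ∘_) ρ-isoˡ) identityʳ) ⟩
    f ∘ (ρ⇐ ∘ ρ⇒)     ≡⟨ sym assoc ⟩
    (f ∘ ρ⇐) ∘ ρ⇒     ≡⟨ cong (_∘ ρ⇒) e ⟩
    (g ∘ ρ⇐) ∘ ρ⇒     ≡⟨ assoc ⟩
    g ∘ (ρ⇐ ∘ ρ⇒)     ≡⟨ trans (cong (g ∘_) ρ-isoˡ) identityʳ ⟩
    g                 ∎

  ρ-conjugate-id : ∀ {A} → ρ⇒ ∘ ((id {A} ⊗₁ id) ∘ ρ⇐) ≡ id
  ρ-conjugate-id = trans (cong (λ k → ρ⇒ ∘ (k ∘ ρ⇐)) ⊗-id)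
                         (trans (cong (ρ⇒ ∘_) identityˡ) ρ-isoʳ)

  ρ-conjugate-0 : ∀ {A} → ρ⇒ ∘ ((id {A} ⊗₁ 0m) ∘ ρ⇐) ≡ 0m
  ρ-conjugate-0 = trans (cong (λ k → ρ⇒ ∘ (k ∘ ρ⇐)) ⊗-zeroʳ)
                        (trans (cong (ρ⇒ ∘_) zeroˡ) zeroʳ)

  swap : ∀ {A B} → A & B ⇒ B & A
  swap = ⟨ p₂ , p₁ ⟩

  swap-∘-⟨⟩ : ∀ {A B D} {f : D ⇒ A} {g : D ⇒ B} → swap ∘ ⟨ f , g ⟩ ≡ ⟨ g , f ⟩
  swap-∘-⟨⟩ = ⟨⟩-unique _ (trans (sym assoc) (trans (cong (_∘ _) p₁-β) p₂-β))
                          (trans (sym assoc) (trans (cong (_∘ _) p₂-β) p₁-β))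

module ExponentialProperties {o ℓ} (C : CartesianSMC o ℓ) (E : ExponentiableI C) where
  open CartesianSMC C
  open ExponentiableI E
  open Canonical C E
  open SymmetricMonoidalProperties C
  open ≡-Reasoning

  uncur : ∀ {Z X} → Z ⇒ S₀ X → Z ⊗₀ I C ⇒ X
  uncur h = ev ∘ (h ⊗₁ id)

  cur-uncur : ∀ {Z X} (h : Z ⇒ S₀ X) → cur (uncur h) ≡ h
  cur-uncur h = sym (cur-unique h refl)

  S-functor : IsFunctor
  S-functor = S-id , S-∘
    where
    S-id : ∀ {X} → S₁ (id {X}) ≡ id
    S-id = sym (cur-unique id (trans (cong (ev ∘_) ⊗-id) (trans identityʳ (sym identityˡ))))
    S-∘ : ∀ {X Y Z} {f : X ⇒ Y} {g : Y ⇒ Z} → S₁ (g ∘ f) ≡ S₁ g ∘ S₁ f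
    S-∘ {f = f} {g} = sym (cur-unique _ (begin
      ev ∘ ((S₁ g ∘ S₁ f) ⊗₁ id)          ≡⟨ cong (ev ∘_) ⊗id-∘ ⟩
      ev ∘ ((S₁ g ⊗₁ id) ∘ (S₁ f ⊗₁ id))  ≡⟨ sym assoc ⟩
      (ev ∘ (S₁ g ⊗₁ id)) ∘ (S₁ f ⊗₁ id)  ≡⟨ cong (_∘ (S₁ f ⊗₁ id)) ev-cur ⟩
      (g ∘ ev) ∘ (S₁ f ⊗₁ id)             ≡⟨ assoc ⟩
      g ∘ (ev ∘ (S₁ f ⊗₁ id))             ≡⟨ cong (g ∘_) ev-cur ⟩
      g ∘ (f ∘ ev)                        ≡⟨ sym assoc ⟩
      (g ∘ f) ∘ ev                        ∎))

  S-preservesZero : PreservesZero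
  S-preservesZero = sym (cur-unique 0m (trans (cong (ev ∘_) ⊗-zeroˡ) (trans zeroʳ (sym zeroˡ))))

  bar-∘ : ∀ (φ : 𝟙 ⇒ I C) {Z X} (h : Z ⇒ S₀ X) →
          bar φ ∘ h ≡ (uncur h ∘ (id ⊗₁ φ)) ∘ ρ⇐
  bar-∘ φ h = begin
    (ev ∘ ((id ⊗₁ φ) ∘ ρ⇐)) ∘ h         ≡⟨ trans assoc (cong (ev ∘_) assoc) ⟩
    ev ∘ ((id ⊗₁ φ) ∘ (ρ⇐ ∘ h))         ≡⟨ cong (λ k → ev ∘ ((id ⊗₁ φ) ∘ k)) ρ⇐-natural ⟩
    ev ∘ ((id ⊗₁ φ) ∘ ((h ⊗₁ id) ∘ ρ⇐)) ≡⟨ cong (ev ∘_) (sym assoc) ⟩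
    ev ∘ (((id ⊗₁ φ) ∘ (h ⊗₁ id)) ∘ ρ⇐) ≡⟨ cong (λ k → ev ∘ (k ∘ ρ⇐)) ⊗-interchange ⟩
    ev ∘ (((h ⊗₁ id) ∘ (id ⊗₁ φ)) ∘ ρ⇐) ≡⟨ trans (cong (ev ∘_) assoc) (sym assoc) ⟩
    uncur h ∘ ((id ⊗₁ φ) ∘ ρ⇐)           ≡⟨ sym assoc ⟩
    (uncur h ∘ (id ⊗₁ φ)) ∘ ρ⇐           ∎

  bar-∘-cur : ∀ (φ : 𝟙 ⇒ I C) {Z X} (k : Z ⊗₀ I C ⇒ X) →
              bar φ ∘ cur k ≡ (k ∘ (id ⊗₁ φ)) ∘ ρ⇐
  bar-∘-cur φ k = trans (bar-∘ φ (cur k)) (cong (λ u → (u ∘ (id ⊗₁ φ)) ∘ ρ⇐) ev-cur)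

  bar-∘-cur-reindex : ∀ (φ : 𝟙 ⇒ I C) {A Z X} (t : I C ⇒ A) (g : Z ⊗₀ A ⇒ X) →
                      bar φ ∘ cur (g ∘ (id ⊗₁ t)) ≡ (g ∘ (id ⊗₁ (t ∘ φ))) ∘ ρ⇐
  bar-∘-cur-reindex φ t g =
    trans (bar-∘-cur φ _) (cong (_∘ ρ⇐) (trans assoc (cong (g ∘_) (sym id⊗-∘))))

  bar-∘-cur-precompose : ∀ (φ : 𝟙 ⇒ I C) {X} (t : I C ⇒ I C) →
                         bar φ ∘ cur (ev {X} ∘ (id ⊗₁ t)) ≡ bar (t ∘ φ)
  bar-∘-cur-precompose φ t = trans (bar-∘-cur-reindex φ t ev) assoc

  bar-natural : ∀ (φ : 𝟙 ⇒ I C) → IsNatural (bar φ)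
  bar-natural φ {f = f} =
    trans (bar-∘-cur φ (f ∘ ev)) (trans (cong (_∘ ρ⇐) assoc) (trans assoc (cong (f ∘_) assoc)))

  π-natural : ∀ i → IsNatural (π i)
  π-natural false = bar-natural w₀
  π-natural true  = bar-natural w₁

  jointlyEpic⇒jointlyMonic : JointlyEpicW → JointlyMonic
  jointlyEpic⇒jointlyMonic epic f g e₀ e₁ = begin
    f              ≡⟨ sym (cur-uncur f) ⟩
    cur (uncur f)  ≡⟨ cong cur (epic _ _ (transport w₀ e₀) (transport w₁ e₁)) ⟩
    cur (uncur g)  ≡⟨ cur-uncur g ⟩
    g              ∎
    where
    transport : ∀ φ → bar φ ∘ f ≡ bar φ ∘ g → uncur f ∘ (id ⊗₁ φ) ≡ uncur g ∘ (id ⊗₁ φ)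
    transport φ e = ρ⇐-cancelʳ (trans (sym (bar-∘ φ f)) (trans e (bar-∘ φ g)))

  jointlyMonic⇒jointlyEpic : JointlyMonic → JointlyEpicW
  jointlyMonic⇒jointlyEpic monic f g e₀ e₁ = begin
    f                   ≡⟨ sym ev-cur ⟩
    ev ∘ (cur f ⊗₁ id)  ≡⟨ cong (λ h → ev ∘ (h ⊗₁ id)) (monic _ _ (transport w₀ e₀) (transport w₁ e₁)) ⟩
    ev ∘ (cur g ⊗₁ id)  ≡⟨ ev-cur ⟩
    g                   ∎
    where
    transport : ∀ φ → f ∘ (id ⊗₁ φ) ≡ g ∘ (id ⊗₁ φ) → bar φ ∘ cur f ≡ bar φ ∘ cur g
    transport φ e = trans (bar-∘-cur φ f) (trans (cong (_∘ ρ⇐) e) (sym (bar-∘-cur φ g)))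

module CanonicalAxioms {o ℓ} (C : CartesianSMC o ℓ) (E : ExponentiableI C) where
  open CartesianSMC C
  open ExponentiableI E
  open Canonical C E
  open SymmetricMonoidalProperties C
  open ExponentialProperties C E
  open ≡-Reasoning

  canonical-S-com : S-com
  canonical-S-com {X} = (cur (ev ∘ (id ⊗₁ swap)) , swapped , swapped) , swapped
    where
    swapped : ∀ {a b} → bar ⟨ a , b ⟩ ∘ cur (ev {X} ∘ (id ⊗₁ swap)) ≡ bar ⟨ b , a ⟩
    swapped = trans (bar-∘-cur-precompose _ swap) (cong (λ φ → bar φ) swap-∘-⟨⟩)

  canonical-S-zero : S-zero
  canonical-S-zero {X} {Y} f = (h , bar-∘-h-id w₀ p₁-β , bar-w₁-∘-h) , bar-∘-h-id Δ p₁-β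
    where
    h : X ⇒ S₀ Y
    h = cur ((f ∘ ρ⇒) ∘ (id ⊗₁ p₁))
    bar-∘-h : ∀ φ → bar φ ∘ h ≡ f ∘ (ρ⇒ ∘ ((id ⊗₁ (p₁ ∘ φ)) ∘ ρ⇐))
    bar-∘-h φ = trans (bar-∘-cur-reindex φ p₁ (f ∘ ρ⇒))
                      (trans (cong (_∘ ρ⇐) assoc) (trans assoc (cong (f ∘_) assoc)))
    bar-∘-h-id : ∀ φ → p₁ ∘ φ ≡ id → bar φ ∘ h ≡ f
    bar-∘-h-id φ e = begin
      bar φ ∘ h                              ≡⟨ bar-∘-h φ ⟩
      f ∘ (ρ⇒ ∘ ((id ⊗₁ (p₁ ∘ φ)) ∘ ρ⇐))     ≡⟨ cong (λ u → f ∘ (ρ⇒ ∘ ((id ⊗₁ u) ∘ ρ⇐))) e ⟩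
      f ∘ (ρ⇒ ∘ ((id ⊗₁ id) ∘ ρ⇐))           ≡⟨ trans (cong (f ∘_) ρ-conjugate-id) identityʳ ⟩
      f                                      ∎
    bar-w₁-∘-h : bar w₁ ∘ h ≡ 0m
    bar-w₁-∘-h = begin
      bar w₁ ∘ h                             ≡⟨ bar-∘-h w₁ ⟩
      f ∘ (ρ⇒ ∘ ((id ⊗₁ (p₁ ∘ w₁)) ∘ ρ⇐))    ≡⟨ cong (λ u → f ∘ (ρ⇒ ∘ ((id ⊗₁ u) ∘ ρ⇐))) p₁-β ⟩
      f ∘ (ρ⇒ ∘ ((id ⊗₁ 0m) ∘ ρ⇐))           ≡⟨ trans (cong (f ∘_) ρ-conjugate-0) zeroʳ ⟩
      0m                                     ∎

  canonical-S-assoc : JointlyMonic → S-witness → S-assoc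
  canonical-S-assoc monic witness {X} = c , flips , monic _ _ (sums false) (sums true)
    where
    rows : ∀ i → Witness (π i {X} ∘ π false) (π i ∘ π true)
    rows i = S₁ (π i) , π-natural false , π-natural true
    rowSums : Summable (bar Δ ∘ S₁ (π false {X})) (bar Δ ∘ S₁ (π true))
    rowSums = bar Δ , sym (bar-natural Δ) , sym (bar-natural Δ)
    cWitness : Witness (S₁ (π false {X})) (S₁ (π true))
    cWitness = witness (rows false) (rows true) rowSums
    c : S₀ (S₀ X) ⇒ S₀ (S₀ X)
    c = proj₁ cWitness
    π-∘-c : ∀ j → π j ∘ c ≡ S₁ (π j)
    π-∘-c false = proj₁ (proj₂ cWitness)
    π-∘-c true  = proj₂ (proj₂ cWitness)
    flips : IsFlip c
    flips i j = trans (cong (π i ∘_) (π-∘-c j)) (π-natural i)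
    sums : ∀ i → π i ∘ (S₁ (bar Δ) ∘ c) ≡ π i ∘ bar Δ
    sums i = begin
      π i ∘ (S₁ (bar Δ) ∘ c)  ≡⟨ sym assoc ⟩
      (π i ∘ S₁ (bar Δ)) ∘ c  ≡⟨ cong (_∘ c) (π-natural i) ⟩
      (bar Δ ∘ π i) ∘ c       ≡⟨ assoc ⟩
      bar Δ ∘ (π i ∘ c)       ≡⟨ cong (bar Δ ∘_) (π-∘-c i) ⟩
      bar Δ ∘ S₁ (π i)        ≡⟨ bar-natural Δ ⟩
      π i ∘ bar Δ             ∎

  condition1⇒canonicallySummable : Condition1 → CanonicallySummable
  condition1⇒canonicallySummable (epic , witness) = record
    { functor      = S-functor
    ; S0≡0         = S-preservesZero
    ; π₀-natural   = bar-natural w₀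
    ; π₁-natural   = bar-natural w₁
    ; σ-natural    = bar-natural Δ
    ; jointlyMonic = jointlyEpic⇒jointlyMonic epic
    ; s-com        = canonical-S-com
    ; s-zero       = canonical-S-zero
    ; s-witness    = witness
    ; s-assoc      = canonical-S-assoc (jointlyEpic⇒jointlyMonic epic) witness
    }

  canonicallySummable⇒condition1 : CanonicallySummable → Condition1
  canonicallySummable⇒condition1 s = jointlyMonic⇒jointlyEpic jointlyMonic , s-witness
    where open IsSummabilityStructure s

mainTheorem10 : ∀ {o ℓ} (C : CartesianSMC o ℓ) (E : ExponentiableI C) →
    Canonical.Condition1 C E ⇔ Canonical.CanonicallySummable C E
mainTheorem10 C E = mk⇔ condition1⇒canonicallySummable canonicallySummable⇒condition1
  where open CanonicalAxioms C E
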